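{- Let $G$ be an undirected graph with nonnegative edge weights $w$, let $\{p_e\}\subseteq[0,1]$ be predictions on its edges, let $C^*$ be a minimum cut of $G$ with respect to which $\eta$ and $\rho$ are defined, and let $B\ge1$. Let $G'$ be a graph with $k$ vertices obtained from $G$ by a sequence of edge contractions in which no edge of $C^*$ was contracted, and let $w_B(e)=(1+(B-1)(1-p_e))w(e)$ for every edge $e$ of $G'$. If $k\ge 2\rho+2$, then the probability that no edge of $C^*$ is contracted in a single random edge contraction in $G'$, where each edge $e$ of $G'$ is chosen with probability $w_B(e)/\sum_{e'\in E(G')}w_B(e')$, is at least $$q_k:=1-\frac{1+(B-1)\eta}{Bk/2-(B-1)(\rho+(1-\eta))}.$$
   Context: For an edge set $E'$, $w(E')=\sum_{e\in E'}w(e)$. A minimum cut is a minimum-weight set of edges crossing a partition of the vertex set into two nonempty parts. $\eta:=\sum_{e\in C^*}(1-p_e)w(e)/w(C^*)$, $\rho:=\sum_{e\in E(G)\setminus C^*}p_ew(e)/w(C^*)$, and $\rho\ge1$ is assumed. Contracting an edge merges its endpoints into a metavertex, removes self-loops and keeps parallel edges, so every edge of $G'$ is an edge of $G$ retaining its weight and prediction.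
   Formalization: The edge weights $w$, the predictions $p_e$ and the parameter $B$ are rational. -}

module Defs where

open import Data.Nat using (ℕ; zero; suc)
open import Data.Fin using (Fin; zero; suc) renaming (_≟_ to _≟ᶠ_)
open import Data.Bool using (Bool; true; false; not; _xor_; _∧_; if_then_else_)
open import Data.Integer using (+_)
open import Data.Rational using (ℚ; 0ℚ; 1ℚ; _+_; _*_; _-_; _÷_; _/_; _≤_; ≢-nonZero)
open import Data.Rational.Properties using (_≟_)
open import Data.Product using (Σ; ∃; _×_; _,_)
open import Data.Sum using (_⊎_)
open import Relation.Nullary using (yes; no; ¬_)
open import Relation.Nullary.Decidable using (⌊_⌋)
open import Relation.Binary.PropositionalEquality using (_≡_; _≢_)

ΣF : (m : ℕ) → (Fin m → ℚ) → ℚ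
ΣF zero    f = 0ℚ
ΣF (suc m) f = f zero + ΣF m (λ i → f (suc i))

-- Division, with the (never used in the theorem) convention x / 0 = 0.
_÷?_ : ℚ → ℚ → ℚ
x ÷? y with y ≟ 0ℚ
... | yes _  = 0ℚ
... | no y≢0 = _÷_ x y {{≢-nonZero y≢0}}

ℕ→ℚ : ℕ → ℚ
ℕ→ℚ k = + k / 1

-- Weighted undirected multigraphs with edge predictions.
-- Vertices Fin n, edges Fin m; edge e joins src e and tgt e.

record WGraph : Set where
  field
    n   : ℕ
    m   : ℕ
    src : Fin m → Fin n
    tgt : Fin m → Fin n
    w   : Fin m → ℚ
    p   : Fin m → ℚ

record WellFormed (G : WGraph) : Set where
  open WGraph G
  field
    loopless : ∀ e → src e ≢ tgt e
    w-nonneg : ∀ e → 0ℚ ≤ w e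
    p-lower  : ∀ e → 0ℚ ≤ p e
    p-upper  : ∀ e → p e ≤ 1ℚ

module _ (G : WGraph) where
  open WGraph G

  ΣE : (Fin m → Bool) → (Fin m → ℚ) → ℚ
  ΣE b f = ΣF m (λ e → if b e then f e else 0ℚ)

  -- Cuts: a vertex 2-colouring S; the cut is the set of crossing edges.

  crosses : (Fin n → Bool) → Fin m → Bool
  crosses S e = S (src e) xor S (tgt e)

  cutWeight : (Fin n → Bool) → ℚ
  cutWeight S = ΣE (crosses S) w

  ProperPartition : (Fin n → Bool) → Set
  ProperPartition S = (∃ λ i → S i ≡ true) × (∃ λ j → S j ≡ false)

  IsMinCut : (Fin n → Bool) → Set
  IsMinCut S = ProperPartition S ×
               (∀ S' → ProperPartition S' → cutWeight S ≤ cutWeight S')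

  η : (Fin n → Bool) → ℚ
  η S = ΣE (crosses S) (λ e → (1ℚ - p e) * w e) ÷? cutWeight S

  ρ : (Fin n → Bool) → ℚ
  ρ S = ΣE (λ e → not (crosses S e)) (λ e → p e * w e) ÷? cutWeight S

  -- A contracted graph with k (meta)vertices is described
  -- by φ : Fin n → Fin k sending each vertex of G to its metavertex; its
  -- edges are exactly the edges of G whose endpoints lie in different
  -- metavertices (self-loops removed, parallel edges kept, weights and
  -- predictions retained).

  inContracted : {k : ℕ} → (Fin n → Fin k) → Fin m → Bool
  inContracted φ e = not ⌊ φ (src e) ≟ᶠ φ (tgt e) ⌋

  Merges : {k : ℕ} → (Fin (suc k) → Fin k) → Fin (suc k) → Fin (suc k) → Set
  Merges {k} ψ x y =
    ψ x ≡ ψ y ×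
    (∀ a b → ψ a ≡ ψ b → a ≡ b ⊎ ((a ≡ x × b ≡ y) ⊎ (a ≡ y × b ≡ x))) ×
    (∀ (c : Fin k) → ∃ λ a → ψ a ≡ c)

  data ContractedAvoiding (S : Fin n → Bool) : (k : ℕ) → (Fin n → Fin k) → Set where
    start : ContractedAvoiding S n (λ v → v)
    step  : ∀ {k} {φ : Fin n → Fin (suc k)} →
            ContractedAvoiding S (suc k) φ →
            (e : Fin m) →
            inContracted φ e ≡ true →
            crosses S e ≡ false →
            (ψ : Fin (suc k) → Fin k) →
            Merges ψ (φ (src e)) (φ (tgt e)) →
            ContractedAvoiding S k (λ v → ψ (φ v))

  wB : ℚ → Fin m → ℚ
  wB B e = (1ℚ + (B - 1ℚ) * (1ℚ - p e)) * w e

  probAvoid : (S : Fin n → Bool) → (B : ℚ) → {k : ℕ} → (Fin n → Fin k) → ℚ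
  probAvoid S B φ =
    ΣE (λ e → inContracted φ e ∧ not (crosses S e)) (wB B)
      ÷? ΣE (inContracted φ) (wB B)

qBound : (B η ρ : ℚ) → ℕ → ℚ
qBound B η ρ k =
  1ℚ - ((1ℚ + (B - 1ℚ) * η) ÷? ((B * ℕ→ℚ k) * (+ 1 / 2) - (B - 1ℚ) * (ρ + (1ℚ - η))))

-- Because no edge of C* has been contracted, every edge of C* survives in G', so
-- w_B(C*) = (1 + (B-1)η) w(C*).  On the other hand every metavertex of G' spans a
-- cut of G, whence k w(C*) ≤ 2 w(G'), while the prediction mass of G' is at most
-- (ρ + (1-η)) w(C*).  Since w_B = B w - (B-1) p w, these give w_B(G') ≥ M w(C*)
-- with M the denominator of q_k, and M ≥ 1 because k ≥ 2ρ + 2.  Hence the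
-- probability of hitting C* is w_B(C*) / w_B(G') ≤ (1 + (B-1)η) / M.
module Submission where

open import Defs
open import Data.Nat using (ℕ)
open import Data.Fin using (Fin)
open import Data.Bool using (Bool)
open import Data.Rational using (ℚ; 1ℚ; _+_; _*_; _≤_)

open import Algebra.Bundles using (CommutativeRing)
open import Data.Bool using (true; false; not; _xor_; _∧_; if_then_else_)
open import Data.Bool.Properties using (xor-same; ∧-zeroʳ)
open import Data.Fin using (zero; suc; punchIn) renaming (_≟_ to _≟ᶠ_)
open import Data.Fin.Properties using (punchInᵢ≢i)
import Data.Integer as ℤ
import Data.Integer.Properties as ℤ
open import Data.Nat as ℕ using (zero; suc; s≤s; z≤n)
open import Data.Nat.Coprimality using (Coprime; 1-coprimeTo) renaming (sym to coprime-sym)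
open import Data.Product using (_,_)
open import Data.Rational
  using (0ℚ; _-_; -_; _<_; _/_; 1/_; *≤*; NonZero; Positive; >-nonZero; ≢-nonZero; positive; nonNegative; mkℚ)
open import Data.Rational.Properties
open import Data.Rational.Solver using (module +-*-Solver)
open import Data.Sum using (inj₁; inj₂)
open import Function.Base using (_∘_)
open import Function.Definitions using (StrictlySurjective)
open import Relation.Nullary using (yes; no; contradiction)
open import Relation.Nullary.Decidable using (⌊_⌋; does; dec-true; dec-false)
open import Relation.Binary.PropositionalEquality
  using (_≡_; _≢_; refl; sym; trans; cong; cong₂; subst; subst₂; module ≡-Reasoning)

import Algebra.Properties.Semiring.Sum as SemiringSum
open SemiringSum (CommutativeRing.semiring +-*-commutativeRing)
  using (sum; sum-cong-≗; ∑-distrib-+; ∑-comm; *-distribˡ-sum; sum-replicate-zero)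
open +-*-Solver

private
  variable
    x y z u v : ℚ

½ : ℚ
½ = ℤ.+ 1 / 2

ℕ→ℚ-suc : ∀ k → ℕ→ℚ (suc k) ≡ 1ℚ + ℕ→ℚ k
ℕ→ℚ-suc k = begin
  ℤ.+ suc k / 1              ≡⟨ /-cong {q₁ = 1} {q₂ = 1} k≡k*1 refl ⟩
  -- unfolds to (1 · 1 + k · 1) / (1 · 1)
  1ℚ + mkℚ (ℤ.+ k) 0 coprime ≡⟨ cong (1ℚ +_) (normalize-coprime coprime) ⟨
  1ℚ + ℕ→ℚ k                 ∎
  where
  open ≡-Reasoning
  coprime : Coprime k 1
  coprime = coprime-sym (1-coprimeTo k)
  k≡k*1 : ℤ.+ suc k ≡ ℤ.1ℤ ℤ.* ℤ.1ℤ ℤ.+ ℤ.+ k ℤ.* ℤ.1ℤ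
  k≡k*1 = cong (ℤ._+_ ℤ.1ℤ) (sym (ℤ.*-identityʳ (ℤ.+ k)))

0≤* : 0ℚ ≤ x → 0ℚ ≤ y → 0ℚ ≤ x * y
0≤* {x} {y} 0≤x 0≤y =
  nonNegative⁻¹ (x * y) {{nonNeg*nonNeg⇒nonNeg x {{nonNegative 0≤x}} y {{nonNegative 0≤y}}}}

x≤y⇒0≤y-x : x ≤ y → 0ℚ ≤ y - x
x≤y⇒0≤y-x {x} {y} x≤y = subst (_≤ y - x) (+-inverseʳ x) (+-monoˡ-≤ (- x) x≤y)

≤-by-difference : ∀ d → y - x ≡ d → 0ℚ ≤ d → x ≤ y
≤-by-difference {y} {x} d y-x≡d 0≤d = subst₂ _≤_ (+-identityʳ x) x+[y-x]≡y x+0≤x+[y-x]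
  where
  x+0≤x+[y-x] : x + 0ℚ ≤ x + (y - x)
  x+0≤x+[y-x] = +-monoʳ-≤ x (subst (0ℚ ≤_) (sym y-x≡d) 0≤d)
  x+[y-x]≡y : x + (y - x) ≡ y
  x+[y-x]≡y = solve 2 (λ x y → x :+ (y :- x) := y) refl x y

2x+2≤k⇒2≤k : ∀ {k} → 0ℚ ≤ x → ℕ→ℚ 2 * x + ℕ→ℚ 2 ≤ ℕ→ℚ k → 2 ℕ.≤ k
2x+2≤k⇒2≤k {x} 0≤x 2x+2≤k = 2≤k (≤-trans (+-monoˡ-≤ (ℕ→ℚ 2) 0≤2x) 2x+2≤k)
  where
  0≤2x : 0ℚ ≤ ℕ→ℚ 2 * x
  0≤2x = 0≤* (nonNegative⁻¹ (ℕ→ℚ 2)) 0≤x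
  2≤k : ∀ {k} → ℕ→ℚ 2 ≤ ℕ→ℚ k → 2 ℕ.≤ k
  2≤k {0}           (*≤* (ℤ.+≤+ ()))
  2≤k {1}           (*≤* (ℤ.+≤+ (s≤s ())))
  2≤k {suc (suc k)} _ = s≤s (s≤s z≤n)

÷?≡* : (0<y : 0ℚ < y) → x ÷? y ≡ x * (1/ y) {{>-nonZero 0<y}}
÷?≡* {y} 0<y with y ≟ 0ℚ
... | yes y≡0 = contradiction (sym y≡0) (<⇒≢ 0<y)
... | no _    = refl

÷?-*-cancelʳ : 0ℚ < y → x ÷? y * y ≡ x
÷?-*-cancelʳ {y} {x} 0<y = begin
  x ÷? y * y        ≡⟨ cong (_* y) (÷?≡* 0<y) ⟩
  x * 1/ y * y      ≡⟨ *-assoc x (1/ y) y ⟩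
  x * (1/ y * y)    ≡⟨ cong (x *_) (*-inverseˡ y) ⟩
  x * 1ℚ            ≡⟨ *-identityʳ x ⟩
  x                 ∎
  where
  open ≡-Reasoning
  instance
    y≢0 : NonZero y
    y≢0 = >-nonZero 0<y

÷?-nonNeg : 0ℚ ≤ x → 0ℚ ≤ y → 0ℚ ≤ x ÷? y
÷?-nonNeg {x} {y} 0≤x 0≤y with y ≟ 0ℚ
... | yes _   = ≤-refl
... | no y≢0 = 0≤* 0≤x (<⇒≤ (positive⁻¹ _ {{1/pos⇒pos y}}))
  where
  instance
    y-pos : Positive y
    y-pos = nonNeg∧nonZero⇒pos y {{nonNegative 0≤y}} {{≢-nonZero y≢0}}

[y-x]÷?y≡1-x÷?y : 0ℚ < y → (y - x) ÷? y ≡ 1ℚ - x ÷? y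
[y-x]÷?y≡1-x÷?y {y} {x} 0<y = begin
  (y - x) ÷? y          ≡⟨ ÷?≡* 0<y ⟩
  (y - x) * 1/ y        ≡⟨ solve 3 (λ y x y⁻¹ → (y :- x) :* y⁻¹ := y :* y⁻¹ :- x :* y⁻¹) refl y x (1/ y) ⟩
  y * 1/ y - x * 1/ y   ≡⟨ cong₂ _-_ (*-inverseʳ y) (sym (÷?≡* 0<y)) ⟩
  1ℚ - x ÷? y           ∎
  where
  open ≡-Reasoning
  instance
    y≢0 : NonZero y
    y≢0 = >-nonZero 0<y

÷?-≤-cross : 0ℚ < y → 0ℚ < v → x * v ≤ u * y → x ÷? y ≤ u ÷? v
÷?-≤-cross {y} {v} {x} {u} 0<y 0<v xv≤uy =
  *-cancelʳ-≤-pos (y * v) {{pos*pos⇒pos y {{positive 0<y}} v {{positive 0<v}}}} (begin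
    x ÷? y * (y * v)    ≡⟨ *-assoc (x ÷? y) y v ⟨
    x ÷? y * y * v      ≡⟨ cong (_* v) (÷?-*-cancelʳ 0<y) ⟩
    x * v               ≤⟨ xv≤uy ⟩
    u * y               ≡⟨ cong (_* y) (÷?-*-cancelʳ 0<v) ⟨
    u ÷? v * v * y      ≡⟨ *-assoc (u ÷? v) v y ⟩
    u ÷? v * (v * y)    ≡⟨ cong (u ÷? v *_) (*-comm v y) ⟩
    u ÷? v * (y * v)    ∎)
  where open ≤-Reasoning

ratio-bound : ∀ {M N c Y} → 0ℚ < M → 0ℚ ≤ N → 0ℚ < c → M * c ≤ N * c + Y →
              1ℚ - N ÷? M ≤ Y ÷? (N * c + Y)
ratio-bound {M} {N} {c} {Y} 0<M 0≤N 0<c Mc≤D = begin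
  1ℚ - N ÷? M        ≡⟨ [y-x]÷?y≡1-x÷?y 0<M ⟨
  (M - N) ÷? M       ≤⟨ ÷?-≤-cross 0<M 0<D cross ⟩
  Y ÷? (N * c + Y)   ∎
  where
  open ≤-Reasoning
  0<D : 0ℚ < N * c + Y
  0<D = <-≤-trans (positive⁻¹ (M * c) {{pos*pos⇒pos M {{positive 0<M}} c {{positive 0<c}}}}) Mc≤D
  cross : (M - N) * (N * c + Y) ≤ Y * M
  cross = ≤-by-difference (N * ((N * c + Y) - M * c))
    (solve 4 (λ M N c Y → Y :* M :- (M :- N) :* (N :* c :+ Y) := N :* ((N :* c :+ Y) :- M :* c))
           refl M N c Y)
    (0≤* 0≤N (x≤y⇒0≤y-x Mc≤D))

qBound-denominator-≥1 : ∀ {B K η ρ} → 1ℚ ≤ B → 0ℚ ≤ η → 0ℚ ≤ ρ → ℕ→ℚ 2 * ρ + ℕ→ℚ 2 ≤ K →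
                        1ℚ ≤ (B * K) * ½ - (B - 1ℚ) * (ρ + (1ℚ - η))
qBound-denominator-≥1 {B} {K} {η} {ρ} 1≤B 0≤η 0≤ρ 2ρ+2≤K = ≤-by-difference
  (B * ((K - (ℕ→ℚ 2 * ρ + ℕ→ℚ 2)) * ½) + (ρ + (B - 1ℚ) * η))
  (solve 4 (λ B K η ρ →
       (B :* K) :* con ½ :- (B :- con 1ℚ) :* (ρ :+ (con 1ℚ :- η)) :- con 1ℚ
    := B :* ((K :- (con (ℕ→ℚ 2) :* ρ :+ con (ℕ→ℚ 2))) :* con ½) :+ (ρ :+ (B :- con 1ℚ) :* η))
    refl B K η ρ)
  (+-mono-≤ (0≤* 0≤B (0≤* (x≤y⇒0≤y-x 2ρ+2≤K) (nonNegative⁻¹ ½)))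
       (+-mono-≤ 0≤ρ (0≤* (x≤y⇒0≤y-x 1≤B) 0≤η)))
  where
  0≤B : 0ℚ ≤ B
  0≤B = ≤-trans (nonNegative⁻¹ 1ℚ) 1≤B

ΣF≡sum : ∀ {m} (f : Fin m → ℚ) → ΣF m f ≡ sum f
ΣF≡sum {zero}  f = refl
ΣF≡sum {suc m} f = cong (f zero +_) (ΣF≡sum (f ∘ suc))

ΣF-cong : ∀ {m} {f g : Fin m → ℚ} → (∀ i → f i ≡ g i) → ΣF m f ≡ ΣF m g
ΣF-cong {f = f} {g} f≗g = trans (ΣF≡sum f) (trans (sum-cong-≗ f≗g) (sym (ΣF≡sum g)))

ΣF-+ : ∀ {m} (f g : Fin m → ℚ) → ΣF m (λ i → f i + g i) ≡ ΣF m f + ΣF m g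
ΣF-+ f g = trans (ΣF≡sum (λ i → f i + g i)) (trans (∑-distrib-+ f g) (sym (cong₂ _+_ (ΣF≡sum f) (ΣF≡sum g))))

ΣF-*ˡ : ∀ {m} a (f : Fin m → ℚ) → ΣF m (λ i → a * f i) ≡ a * ΣF m f
ΣF-*ˡ a f = trans (ΣF≡sum (λ i → a * f i)) (trans (sym (*-distribˡ-sum a f)) (cong (a *_) (sym (ΣF≡sum f))))

ΣF-zero : ∀ m → ΣF m (λ _ → 0ℚ) ≡ 0ℚ
ΣF-zero m = trans (ΣF≡sum {m} (λ _ → 0ℚ)) (sum-replicate-zero m)

ΣF-comm : ∀ {k m} (f : Fin k → Fin m → ℚ) →
          ΣF k (λ j → ΣF m (f j)) ≡ ΣF m (λ e → ΣF k (λ j → f j e))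
ΣF-comm f = begin
  ΣF _ (λ j → ΣF _ (f j))         ≡⟨ trans (ΣF-cong (ΣF≡sum ∘ f)) (ΣF≡sum (λ j → sum (f j))) ⟩
  sum (λ j → sum (f j))           ≡⟨ ∑-comm f ⟩
  sum (λ e → sum (λ j → f j e))   ≡⟨ trans (ΣF-cong (λ e → ΣF≡sum (λ j → f j e))) (ΣF≡sum (λ e → sum (λ j → f j e))) ⟨
  ΣF _ (λ e → ΣF _ (λ j → f j e)) ∎
  where open ≡-Reasoning

ΣF-mono-≤ : ∀ {m} {f g : Fin m → ℚ} → (∀ i → f i ≤ g i) → ΣF m f ≤ ΣF m g
ΣF-mono-≤ {zero}  f≤g = ≤-refl
ΣF-mono-≤ {suc m} f≤g = +-mono-≤ (f≤g zero) (ΣF-mono-≤ (f≤g ∘ suc))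

ΣF-nonNeg : ∀ {m} {f : Fin m → ℚ} → (∀ i → 0ℚ ≤ f i) → 0ℚ ≤ ΣF m f
ΣF-nonNeg {m} {f} 0≤f = subst (_≤ ΣF m f) (ΣF-zero m) (ΣF-mono-≤ 0≤f)

ΣF-const : ∀ m x → ΣF m (λ _ → x) ≡ ℕ→ℚ m * x
ΣF-const zero    x = sym (*-zeroˡ x)
ΣF-const (suc m) x = begin
  x + ΣF m (λ _ → x)    ≡⟨ cong₂ _+_ (sym (*-identityˡ x)) (ΣF-const m x) ⟩
  1ℚ * x + ℕ→ℚ m * x    ≡⟨ *-distribʳ-+ x 1ℚ (ℕ→ℚ m) ⟨
  (1ℚ + ℕ→ℚ m) * x      ≡⟨ cong (_* x) (ℕ→ℚ-suc m) ⟨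
  ℕ→ℚ (suc m) * x       ∎
  where open ≡-Reasoning

-- Stated with does rather than ⌊_⌋ (= isYes), since only does reduces on suc i ≟ suc j.
ΣF-indicator : ∀ {k} (i : Fin k) x → ΣF k (λ j → if does (i ≟ᶠ j) then x else 0ℚ) ≡ x
ΣF-indicator {suc k} zero    x = trans (cong (x +_) (ΣF-zero k)) (+-identityʳ x)
ΣF-indicator {suc k} (suc i) x =
  trans (+-identityˡ (ΣF k (λ j → if does (i ≟ᶠ j) then x else 0ℚ))) (ΣF-indicator i x)

ΣF-xor-indicator : ∀ {k} (a b : Fin k) → 0ℚ ≤ x →
  ΣF k (λ j → if does (a ≟ᶠ j) xor does (b ≟ᶠ j) then x else 0ℚ)
    ≤ ℕ→ℚ 2 * (if not ⌊ a ≟ᶠ b ⌋ then x else 0ℚ)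
ΣF-xor-indicator {x} {k} a b 0≤x with a ≟ᶠ b
... | yes refl = ≤-reflexive (begin-equality
  ΣF k (λ j → if does (a ≟ᶠ j) xor does (a ≟ᶠ j) then x else 0ℚ)
    ≡⟨ ΣF-cong (λ j → cong (if_then x else 0ℚ) (xor-same (does (a ≟ᶠ j)))) ⟩
  ΣF k (λ _ → 0ℚ)   ≡⟨ ΣF-zero k ⟩
  0ℚ                ≡⟨ *-zeroʳ (ℕ→ℚ 2) ⟨
  ℕ→ℚ 2 * 0ℚ        ∎)
  where open ≤-Reasoning
... | no _ = begin
  ΣF k (λ j → if does (a ≟ᶠ j) xor does (b ≟ᶠ j) then x else 0ℚ)
    ≤⟨ ΣF-mono-≤ (λ j → if-xor-≤ (does (a ≟ᶠ j)) (does (b ≟ᶠ j)) 0≤x) ⟩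
  ΣF k (λ j → (if does (a ≟ᶠ j) then x else 0ℚ) + (if does (b ≟ᶠ j) then x else 0ℚ))
    ≡⟨ ΣF-+ (λ j → if does (a ≟ᶠ j) then x else 0ℚ) (λ j → if does (b ≟ᶠ j) then x else 0ℚ) ⟩
  ΣF k (λ j → if does (a ≟ᶠ j) then x else 0ℚ) + ΣF k (λ j → if does (b ≟ᶠ j) then x else 0ℚ)
    ≡⟨ cong₂ _+_ (ΣF-indicator a x) (ΣF-indicator b x) ⟩
  x + x
    ≡⟨ solve 1 (λ x → x :+ x := con (ℕ→ℚ 2) :* x) refl x ⟩
  ℕ→ℚ 2 * x ∎
  where
  open ≤-Reasoning
  if-xor-≤ : ∀ c d → 0ℚ ≤ x →
    (if c xor d then x else 0ℚ) ≤ (if c then x else 0ℚ) + (if d then x else 0ℚ)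
  if-xor-≤ true  true  0≤x = +-mono-≤ 0≤x 0≤x
  if-xor-≤ true  false _   = ≤-reflexive (sym (+-identityʳ x))
  if-xor-≤ false true  _   = ≤-reflexive (sym (+-identityˡ x))
  if-xor-≤ false false _   = ≤-refl

xor≡false⇒≡ : ∀ {a b} → a xor b ≡ false → a ≡ b
xor≡false⇒≡ {true}  {true}  _ = refl
xor≡false⇒≡ {false} {false} _ = refl

module _ (G : WGraph) where
  open WGraph G

  ΣE-linear : ∀ b a a′ {f g h : Fin m → ℚ} → (∀ e → h e ≡ a * f e + a′ * g e) →
              ΣE G b h ≡ a * ΣE G b f + a′ * ΣE G b g
  ΣE-linear b a a′ {f} {g} {h} h≡af+a′g = begin
    ΣE G b h                                     ≡⟨ ΣF-cong (λ e → if-linear (b e) (h≡af+a′g e)) ⟩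
    ΣF m (λ e → a * f₀ e + a′ * g₀ e)            ≡⟨ ΣF-+ (λ e → a * f₀ e) (λ e → a′ * g₀ e) ⟩
    ΣF m (λ e → a * f₀ e) + ΣF m (λ e → a′ * g₀ e) ≡⟨ cong₂ _+_ (ΣF-*ˡ a f₀) (ΣF-*ˡ a′ g₀) ⟩
    a * ΣE G b f + a′ * ΣE G b g                 ∎
    where
    open ≡-Reasoning
    f₀ g₀ : Fin m → ℚ
    f₀ e = if b e then f e else 0ℚ
    g₀ e = if b e then g e else 0ℚ
    if-linear : ∀ c → z ≡ a * x + a′ * y →
                (if c then z else 0ℚ) ≡ a * (if c then x else 0ℚ) + a′ * (if c then y else 0ℚ)
    if-linear true  z≡ = z≡
    if-linear false _  = solve 2 (λ a a′ → con 0ℚ := a :* con 0ℚ :+ a′ :* con 0ℚ) refl a a′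

  ΣE-split : ∀ (b c : Fin m → Bool) f → ΣE G b f ≡ ΣE G (λ e → b e ∧ c e) f + ΣE G (λ e → b e ∧ not (c e)) f
  ΣE-split b c f = trans (ΣF-cong (λ e → if-split (b e) (c e)))
                         (ΣF-+ (λ e → if b e ∧ c e then f e else 0ℚ) (λ e → if b e ∧ not (c e) then f e else 0ℚ))
    where
    if-split : ∀ b c → (if b then x else 0ℚ) ≡ (if b ∧ c then x else 0ℚ) + (if b ∧ not c then x else 0ℚ)
    if-split true  true  = sym (+-identityʳ _)
    if-split true  false = sym (+-identityˡ _)
    if-split false _     = refl

  ΣE-∧-⊆ : ∀ (b c : Fin m → Bool) f → (∀ e → c e ≡ true → b e ≡ true) →
           ΣE G (λ e → b e ∧ c e) f ≡ ΣE G c f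
  ΣE-∧-⊆ b c f c⊆b = ΣF-cong (λ e → cong (if_then f e else 0ℚ) (∧-⊆ (b e) (c e) (c⊆b e)))
    where
    ∧-⊆ : ∀ b c → (c ≡ true → b ≡ true) → b ∧ c ≡ c
    ∧-⊆ b     false _   = ∧-zeroʳ b
    ∧-⊆ true  true  _   = refl
    ∧-⊆ false true  c⊆b = c⊆b refl

  ΣE-∧-≤ : ∀ (b c : Fin m → Bool) {f} → (∀ e → 0ℚ ≤ f e) → ΣE G (λ e → b e ∧ c e) f ≤ ΣE G c f
  ΣE-∧-≤ b c 0≤f = ΣF-mono-≤ (λ e → if-∧-≤ (b e) (c e) (0≤f e))
    where
    if-∧-≤ : ∀ b c → 0ℚ ≤ x → (if b ∧ c then x else 0ℚ) ≤ (if c then x else 0ℚ)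
    if-∧-≤ true  c     _   = ≤-refl
    if-∧-≤ false true  0≤x = 0≤x
    if-∧-≤ false false _   = ≤-refl

  ΣE-nonNeg : ∀ b {f} → (∀ e → 0ℚ ≤ f e) → 0ℚ ≤ ΣE G b f
  ΣE-nonNeg b 0≤f = ΣF-nonNeg (λ e → if-nonNeg (b e) (0≤f e))
    where
    if-nonNeg : ∀ b → 0ℚ ≤ x → 0ℚ ≤ (if b then x else 0ℚ)
    if-nonNeg true  0≤x = 0≤x
    if-nonNeg false _   = ≤-refl

  star : ∀ {k} → (Fin n → Fin k) → Fin k → Fin n → Bool
  star φ j v = does (φ v ≟ᶠ j)

  star-proper : ∀ {k} {φ : Fin n → Fin (suc (suc k))} → StrictlySurjective _≡_ φ →
                ∀ j → ProperPartition G (star φ j)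
  star-proper {φ = φ} φ-onto j =
    let (v , φv≡j) = φ-onto j
        (v′ , φv′≡j′) = φ-onto (punchIn j zero)
    in (v , dec-true (φ v ≟ᶠ j) φv≡j) ,
       (v′ , dec-false (φ v′ ≟ᶠ j) (punchInᵢ≢i j zero ∘ trans (sym φv′≡j′)))

  Σ-cutWeight-star-≤ : (∀ e → 0ℚ ≤ w e) → ∀ {k} (φ : Fin n → Fin k) →
    ΣF k (λ j → cutWeight G (star φ j)) ≤ ℕ→ℚ 2 * ΣE G (inContracted G φ) w
  Σ-cutWeight-star-≤ 0≤w {k} φ = begin
    ΣF k (λ j → cutWeight G (star φ j))
      ≡⟨ ΣF-comm (λ j e → if crosses G (star φ j) e then w e else 0ℚ) ⟩
    ΣF m (λ e → ΣF k (λ j → if crosses G (star φ j) e then w e else 0ℚ))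
      ≤⟨ ΣF-mono-≤ (λ e → ΣF-xor-indicator (φ (src e)) (φ (tgt e)) (0≤w e)) ⟩
    ΣF m (λ e → ℕ→ℚ 2 * (if inContracted G φ e then w e else 0ℚ))
      ≡⟨ ΣF-*ˡ (ℕ→ℚ 2) (λ e → if inContracted G φ e then w e else 0ℚ) ⟩
    ℕ→ℚ 2 * ΣE G (inContracted G φ) w ∎
    where open ≤-Reasoning

  mincut-≤-contracted-weight : ∀ {S} → IsMinCut G S → (∀ e → 0ℚ ≤ w e) →
    ∀ {k} {φ : Fin n → Fin k} → StrictlySurjective _≡_ φ → 2 ℕ.≤ k →
    ℕ→ℚ k * cutWeight G S ≤ ℕ→ℚ 2 * ΣE G (inContracted G φ) w
  mincut-≤-contracted-weight {S} (_ , S-min) 0≤w {k} {φ} φ-onto (s≤s (s≤s z≤n)) = begin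
    ℕ→ℚ k * cutWeight G S                ≡⟨ ΣF-const k (cutWeight G S) ⟨
    ΣF k (λ _ → cutWeight G S)           ≤⟨ ΣF-mono-≤ (λ j → S-min (star φ j) (star-proper φ-onto j)) ⟩
    ΣF k (λ j → cutWeight G (star φ j))  ≤⟨ Σ-cutWeight-star-≤ 0≤w φ ⟩
    ℕ→ℚ 2 * ΣE G (inContracted G φ) w    ∎
    where open ≤-Reasoning

  module _ {S : Fin n → Bool} where

    contracted-onto : ∀ {k φ} → ContractedAvoiding G S k φ → StrictlySurjective _≡_ φ
    contracted-onto start c = c , refl
    contracted-onto (step G′ _ _ _ ψ (_ , _ , ψ-onto)) c =
      let (a , ψa≡c) = ψ-onto c
          (v , φv≡a) = contracted-onto G′ a
      in v , trans (cong ψ φv≡a) ψa≡c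

    contracted-respects-cut : ∀ {k φ} → ContractedAvoiding G S k φ →
                              ∀ {u v} → φ u ≡ φ v → S u ≡ S v
    contracted-respects-cut start φu≡φv = cong S φu≡φv
    contracted-respects-cut (step {φ = φ} G′ e _ e∉C ψ (_ , merges-only , _)) {u} {v} ψφu≡ψφv
      with merges-only (φ u) (φ v) ψφu≡ψφv
    ... | inj₁ φu≡φv = contracted-respects-cut G′ φu≡φv
    ... | inj₂ (inj₁ (φu≡φs , φv≡φt)) =
      trans (contracted-respects-cut G′ φu≡φs)
            (trans (xor≡false⇒≡ e∉C) (sym (contracted-respects-cut G′ φv≡φt)))
    ... | inj₂ (inj₂ (φu≡φt , φv≡φs)) =
      trans (contracted-respects-cut G′ φu≡φt)
            (trans (sym (xor≡false⇒≡ e∉C)) (sym (contracted-respects-cut G′ φv≡φs)))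

    cut-edges-survive : ∀ {k φ} → ContractedAvoiding G S k φ →
                        ∀ e → crosses G S e ≡ true → inContracted G φ e ≡ true
    cut-edges-survive {φ = φ} G′ e e∈C with φ (src e) ≟ᶠ φ (tgt e)
    ... | no _      = refl
    ... | yes φs≡φt = contradiction false≡true λ ()
      where
      false≡true : false ≡ true
      false≡true = trans (sym (xor-same (S (tgt e))))
                         (subst (λ s → s xor S (tgt e) ≡ true) (contracted-respects-cut G′ φs≡φt) e∈C)

module _ (G : WGraph) (wf : WellFormed G) (S : Fin (WGraph.n G) → Bool) where
  open WGraph G
  open WellFormed wf

  -- ρ is defined with the convention x ÷? 0 = 0, so ρ ≥ 1 rules out a cut of weight zero.
  cutWeight-pos : 1ℚ ≤ ρ G S → 0ℚ < cutWeight G S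
  cutWeight-pos 1≤ρ =
    positive⁻¹ c {{nonNeg∧nonZero⇒pos c {{nonNegative 0≤c}} {{≢-nonZero c≢0}}}}
    where
    c : ℚ
    c = cutWeight G S
    0≤c : 0ℚ ≤ c
    0≤c = ΣE-nonNeg G (crosses G S) w-nonneg
    c≢0 : c ≢ 0ℚ
    c≢0 c≡0 = <-irrefl refl (<-≤-trans (positive⁻¹ 1ℚ) (subst (λ d → 1ℚ ≤ R ÷? d) c≡0 1≤ρ))
      where
      R : ℚ
      R = ΣE G (λ e → not (crosses G S e)) (λ e → p e * w e)

  η-nonNeg : 0ℚ < cutWeight G S → 0ℚ ≤ η G S
  η-nonNeg 0<c = ÷?-nonNeg (ΣE-nonNeg G (crosses G S) (λ e → 0≤* (x≤y⇒0≤y-x (p-upper e)) (w-nonneg e)))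
                           (<⇒≤ 0<c)

  module _ {k} (φ : Fin n → Fin k)
           (survive : ∀ e → crosses G S e ≡ true → inContracted G φ e ≡ true)
           (0<c : 0ℚ < cutWeight G S) where

    ΣE-surviving-cut : ∀ a a′ {f} → (∀ e → f e ≡ a * w e + a′ * ((1ℚ - p e) * w e)) →
      ΣE G (λ e → inContracted G φ e ∧ crosses G S e) f ≡ (a + a′ * η G S) * cutWeight G S
    ΣE-surviving-cut a a′ {f} f≡aw+a′qw = begin
      ΣE G (λ e → inContracted G φ e ∧ crosses G S e) f
        ≡⟨ ΣE-∧-⊆ G (inContracted G φ) (crosses G S) f survive ⟩
      ΣE G (crosses G S) f
        ≡⟨ ΣE-linear G (crosses G S) a a′ f≡aw+a′qw ⟩
      a * c + a′ * ΣE G (crosses G S) (λ e → (1ℚ - p e) * w e)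
        ≡⟨ cong (λ t → a * c + a′ * t) (÷?-*-cancelʳ 0<c) ⟨
      a * c + a′ * (η G S * c)
        ≡⟨ solve 4 (λ a a′ η c → a :* c :+ a′ :* (η :* c) := (a :+ a′ :* η) :* c) refl a a′ (η G S) c ⟩
      (a + a′ * η G S) * c ∎
      where
      open ≡-Reasoning
      c : ℚ
      c = cutWeight G S

    wB-contracted≡ : ∀ B → ΣE G (inContracted G φ) (wB G B)
      ≡ (1ℚ + (B - 1ℚ) * η G S) * cutWeight G S
        + ΣE G (λ e → inContracted G φ e ∧ not (crosses G S e)) (wB G B)
    wB-contracted≡ B = trans (ΣE-split G (inContracted G φ) (crosses G S) (wB G B))
                             (cong (_+ ΣE G (λ e → inContracted G φ e ∧ not (crosses G S e)) (wB G B))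
                                   (ΣE-surviving-cut 1ℚ (B - 1ℚ) (λ e → wB≡ B (p e) (w e))))
      where
      wB≡ : ∀ B p w → (1ℚ + (B - 1ℚ) * (1ℚ - p)) * w ≡ 1ℚ * w + (B - 1ℚ) * ((1ℚ - p) * w)
      wB≡ = solve 3 (λ B p w → (con 1ℚ :+ (B :- con 1ℚ) :* (con 1ℚ :- p)) :* w
                            := con 1ℚ :* w :+ (B :- con 1ℚ) :* ((con 1ℚ :- p) :* w)) refl

    prediction-mass-≤ : ΣE G (inContracted G φ) (λ e → p e * w e) ≤ (ρ G S + (1ℚ - η G S)) * cutWeight G S
    prediction-mass-≤ = begin
      ΣE G (inContracted G φ) pw
        ≡⟨ ΣE-split G (inContracted G φ) (crosses G S) pw ⟩
      ΣE G (λ e → inContracted G φ e ∧ crosses G S e) pw + ΣE G (λ e → inContracted G φ e ∧ not (crosses G S e)) pw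
        ≤⟨ +-mono-≤ (≤-reflexive (ΣE-surviving-cut 1ℚ (- 1ℚ) (λ e → pw≡ (p e) (w e))))
                    (ΣE-∧-≤ G (inContracted G φ) (λ e → not (crosses G S e)) 0≤pw) ⟩
      (1ℚ + - 1ℚ * η G S) * c + ΣE G (λ e → not (crosses G S e)) pw
        ≡⟨ cong ((1ℚ + - 1ℚ * η G S) * c +_) (÷?-*-cancelʳ 0<c) ⟨
      (1ℚ + - 1ℚ * η G S) * c + ρ G S * c
        ≡⟨ solve 3 (λ η ρ c → (con 1ℚ :+ :- con 1ℚ :* η) :* c :+ ρ :* c := (ρ :+ (con 1ℚ :- η)) :* c)
                 refl (η G S) (ρ G S) c ⟩
      (ρ G S + (1ℚ - η G S)) * c ∎
      where
      open ≤-Reasoning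
      c : ℚ
      c = cutWeight G S
      pw : Fin m → ℚ
      pw e = p e * w e
      0≤pw : ∀ e → 0ℚ ≤ pw e
      0≤pw e = 0≤* (p-lower e) (w-nonneg e)
      pw≡ : ∀ p w → p * w ≡ 1ℚ * w + - 1ℚ * ((1ℚ - p) * w)
      pw≡ = solve 2 (λ p w → p :* w := con 1ℚ :* w :+ :- con 1ℚ :* ((con 1ℚ :- p) :* w)) refl

    wB-contracted-≥ : ∀ {B} → 1ℚ ≤ B →
      ℕ→ℚ k * cutWeight G S ≤ ℕ→ℚ 2 * ΣE G (inContracted G φ) w →
      ((B * ℕ→ℚ k) * ½ - (B - 1ℚ) * (ρ G S + (1ℚ - η G S))) * cutWeight G S
        ≤ ΣE G (inContracted G φ) (wB G B)
    wB-contracted-≥ {B} 1≤B kc≤2W = begin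
      ((B * K) * ½ - (B - 1ℚ) * σ) * c
        ≡⟨ solve 4 (λ B K σ c → ((B :* K) :* con ½ :- (B :- con 1ℚ) :* σ) :* c
                             := B :* (K :* c :* con ½) :- (B :- con 1ℚ) :* (σ :* c)) refl B K σ c ⟩
      B * (K * c * ½) - (B - 1ℚ) * (σ * c)
        ≤⟨ +-mono-≤ (*-monoˡ-≤-nonNeg B {{nonNegative 0≤B}} (*-monoʳ-≤-nonNeg ½ kc≤2W))
                    (neg-antimono-≤ (*-monoˡ-≤-nonNeg (B - 1ℚ) {{nonNegative 0≤B-1}} prediction-mass-≤)) ⟩
      B * (ℕ→ℚ 2 * W * ½) - (B - 1ℚ) * P
        ≡⟨ solve 3 (λ B W P → B :* (con (ℕ→ℚ 2) :* W :* con ½) :- (B :- con 1ℚ) :* P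
                           := B :* W :+ (:- (B :- con 1ℚ)) :* P) refl B W P ⟩
      B * W + - (B - 1ℚ) * P
        ≡⟨ ΣE-linear G (inContracted G φ) B (- (B - 1ℚ)) (λ e → wB≡ B (p e) (w e)) ⟨
      ΣE G (inContracted G φ) (wB G B) ∎
      where
      open ≤-Reasoning
      K c σ W P : ℚ
      K = ℕ→ℚ k
      c = cutWeight G S
      σ = ρ G S + (1ℚ - η G S)
      W = ΣE G (inContracted G φ) w
      P = ΣE G (inContracted G φ) (λ e → p e * w e)
      0≤B-1 : 0ℚ ≤ B - 1ℚ
      0≤B-1 = x≤y⇒0≤y-x 1≤B
      0≤B : 0ℚ ≤ B
      0≤B = ≤-trans (nonNegative⁻¹ 1ℚ) 1≤B
      wB≡ : ∀ B p w → (1ℚ + (B - 1ℚ) * (1ℚ - p)) * w ≡ B * w + - (B - 1ℚ) * (p * w)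
      wB≡ = solve 3 (λ B p w → (con 1ℚ :+ (B :- con 1ℚ) :* (con 1ℚ :- p)) :* w
                            := B :* w :+ (:- (B :- con 1ℚ)) :* (p :* w)) refl

lemma3 : (G : WGraph) → WellFormed G →
         (S : Fin (WGraph.n G) → Bool) → IsMinCut G S →
         1ℚ ≤ ρ G S →
         (B : ℚ) → 1ℚ ≤ B →
         (k : ℕ) → (φ : Fin (WGraph.n G) → Fin k) →
         ContractedAvoiding G S k φ →
         ℕ→ℚ 2 * ρ G S + ℕ→ℚ 2 ≤ ℕ→ℚ k →
         qBound B (η G S) (ρ G S) k ≤ probAvoid G S B φ
lemma3 G wf S S-min 1≤ρ B 1≤B k φ G′ 2ρ+2≤k = begin
  1ℚ - N ÷? M        ≤⟨ ratio-bound 0<M 0≤N 0<c (subst (M * c ≤_) D≡Nc+Y Mc≤D) ⟩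
  Y ÷? (N * c + Y)   ≡⟨ cong (Y ÷?_) D≡Nc+Y ⟨
  probAvoid G S B φ  ∎
  where
  open ≤-Reasoning
  open WellFormed wf
  c N M Y : ℚ
  c = cutWeight G S
  N = 1ℚ + (B - 1ℚ) * η G S
  M = (B * ℕ→ℚ k) * ½ - (B - 1ℚ) * (ρ G S + (1ℚ - η G S))
  Y = ΣE G (λ e → inContracted G φ e ∧ not (crosses G S e)) (wB G B)
  0<c : 0ℚ < c
  0<c = cutWeight-pos G wf S 1≤ρ
  0≤ρ : 0ℚ ≤ ρ G S
  0≤ρ = ≤-trans (nonNegative⁻¹ 1ℚ) 1≤ρ
  0≤η : 0ℚ ≤ η G S
  0≤η = η-nonNeg G wf S 0<c
  0<M : 0ℚ < M
  0<M = <-≤-trans (positive⁻¹ 1ℚ) (qBound-denominator-≥1 1≤B 0≤η 0≤ρ 2ρ+2≤k)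
  0≤N : 0ℚ ≤ N
  0≤N = +-mono-≤ (nonNegative⁻¹ 1ℚ) (0≤* (x≤y⇒0≤y-x 1≤B) 0≤η)
  survive : ∀ e → crosses G S e ≡ true → inContracted G φ e ≡ true
  survive = cut-edges-survive G G′
  D≡Nc+Y : ΣE G (inContracted G φ) (wB G B) ≡ N * c + Y
  D≡Nc+Y = wB-contracted≡ G wf S φ survive 0<c B
  Mc≤D : M * c ≤ ΣE G (inContracted G φ) (wB G B)
  Mc≤D = wB-contracted-≥ G wf S φ survive 0<c 1≤B
           (mincut-≤-contracted-weight G S-min w-nonneg (contracted-onto G G′) (2x+2≤k⇒2≤k 0≤ρ 2ρ+2≤k))
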